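{- For any integers $\ell_1,\ell_2\geq 2$ and $\ell\geq 4$, the class of $\{C^V_{4\ell_1,4\ell_2},C^E_{4\ell_1,4\ell_2}\}$-subgraph-free graphs of diameter at most $3$ and the class of $\{C^V_{2\ell,2\ell},C^E_{2\ell,2\ell}\}$-subgraph-free graphs of diameter at most $3$ both have unbounded treedepth.
   Context: All graphs are finite, simple and undirected. For integers $a,b\geq 3$, $C^V_{a,b}$ is the graph consisting of a cycle on $a$ vertices and a cycle on $b$ vertices sharing exactly one vertex, and $C^E_{a,b}$ is the graph consisting of a cycle on $a$ vertices and a cycle on $b$ vertices sharing exactly one edge (and its two endpoints). A graph is $\mathcal{F}$-subgraph-free for a set $\mathcal{F}$ of graphs if it contains no subgraph isomorphic to a member of $\mathcal{F}$. The diameter of $G$ is the maximum distance between two vertices (infinite if disconnected). The treedepth of $G$ is the minimum height of a rooted forest $T$ with $V(T)=V(G)$ such that the endpoints of every edge of $G$ lie on a common root-to-leaf path of $T$; unbounded treedepth means no constant bounds the treedepth of all graphs in the class. -}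

module Defs where

open import Level using (0ℓ)
open import Data.Nat using (ℕ; zero; suc; _+_; _*_; _∸_; _<_; _≤_)
open import Data.Fin using (Fin; toℕ)
open import Data.Maybe using (Maybe; just; nothing)
open import Data.Sum using (_⊎_; inj₁; inj₂)
open import Data.Product using (Σ; _×_; _,_)
open import Relation.Nullary using (¬_)
open import Data.Empty using (⊥)
open import Relation.Binary.PropositionalEquality using (_≡_)

record SimpleGraph (n : ℕ) : Set₁ where
  field
    Adj    : Fin n → Fin n → Set
    sym    : ∀ {x y} → Adj x y → Adj y x
    irrefl : ∀ {x} → ¬ Adj x x
open SimpleGraph public

-- Pattern graphs: a vertex type with an edge relation (the pattern's
-- edge set is the symmetric closure of E; since host graphs are
-- symmetric, the orientation of E is irrelevant).

record Pattern : Set₁ where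
  field
    PV : Set
    PE : PV → PV → Set
open Pattern public

Contains : ∀ {n} → SimpleGraph n → Pattern → Set
Contains G P =
  Σ (PV P → Fin _) λ f →
    (∀ x y → f x ≡ f y → x ≡ y) ×
    (∀ x y → PE P x y → Adj G (f x) (f y))

SubgraphFree : ∀ {n} → SimpleGraph n → Pattern → Set
SubgraphFree G P = ¬ Contains G P

CycE : (a : ℕ) → Fin a → Fin a → Set
CycE a i j = (toℕ j ≡ suc (toℕ i)) ⊎ ((toℕ i ≡ a ∸ 1) × (toℕ j ≡ 0))

PathE : (m : ℕ) → Fin m → Fin m → Set
PathE m i j = toℕ j ≡ suc (toℕ i)

-- C^V_{a,b}: cycle 0,1,...,a-1 (vertices inj₁ i) together with a second
-- cycle through the vertex inj₁ 0 and the b-1 new vertices inj₂ 0..b-2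
-- (path inj₂ 0 - ... - inj₂ (b-2), closed up through inj₁ 0).
CVE : (a b : ℕ) → Fin a ⊎ Fin (b ∸ 1) → Fin a ⊎ Fin (b ∸ 1) → Set
CVE a b (inj₁ i) (inj₁ j) = CycE a i j
CVE a b (inj₂ i) (inj₂ j) = PathE (b ∸ 1) i j
CVE a b (inj₁ i) (inj₂ j) = (toℕ i ≡ 0) × ((toℕ j ≡ 0) ⊎ (toℕ j ≡ b ∸ 2))
CVE a b (inj₂ j) (inj₁ i) = ⊥

CV : (a b : ℕ) → Pattern
CV a b = record { PV = Fin a ⊎ Fin (b ∸ 1) ; PE = CVE a b }

-- C^E_{a,b}: cycle 0,1,...,a-1 (vertices inj₁ i) together with a second
-- cycle sharing the edge inj₁ 0 -- inj₁ 1, formed with the b-2 new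
-- vertices inj₂ 0..b-3: inj₁ 0 - inj₂ 0 - ... - inj₂ (b-3) - inj₁ 1.
CEE : (a b : ℕ) → Fin a ⊎ Fin (b ∸ 2) → Fin a ⊎ Fin (b ∸ 2) → Set
CEE a b (inj₁ i) (inj₁ j) = CycE a i j
CEE a b (inj₂ i) (inj₂ j) = PathE (b ∸ 2) i j
CEE a b (inj₁ i) (inj₂ j) =
  ((toℕ i ≡ 0) × (toℕ j ≡ 0)) ⊎ ((toℕ i ≡ 1) × (toℕ j ≡ b ∸ 3))
CEE a b (inj₂ j) (inj₁ i) = ⊥

CE : (a b : ℕ) → Pattern
CE a b = record { PV = Fin a ⊎ Fin (b ∸ 2) ; PE = CEE a b }

data DistLe {n} (G : SimpleGraph n) : ℕ → Fin n → Fin n → Set where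
  here : ∀ {m x} → DistLe G m x x
  step : ∀ {m x y z} → Adj G x y → DistLe G m y z → DistLe G (suc m) x z

DiamLe : ∀ {n} → SimpleGraph n → ℕ → Set
DiamLe G m = ∀ x y → DistLe G m x y

-- A rooted forest on Fin n: a parent function together with a depth
-- function (roots have depth 0, children have depth one more than
-- their parent); the depth function witnesses acyclicity.
record RootedForest (n : ℕ) : Set where
  field
    parent      : Fin n → Maybe (Fin n)
    depth       : Fin n → ℕ
    depth-root  : ∀ x → parent x ≡ nothing → depth x ≡ 0
    depth-child : ∀ x p → parent x ≡ just p → depth x ≡ suc (depth p)
open RootedForest public

data Anc {n} (F : RootedForest n) : Fin n → Fin n → Set where
  self : ∀ {x} → Anc F x x
  up   : ∀ {x y p} → parent F y ≡ just p → Anc F x p → Anc F x y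

-- Height of F is at most k: every root-to-leaf path has at most k
-- vertices, i.e. every vertex has depth < k.
HeightLe : ∀ {n} → RootedForest n → ℕ → Set
HeightLe F k = ∀ x → depth F x < k

Elimination : ∀ {n} → SimpleGraph n → RootedForest n → Set
Elimination G F = ∀ x y → Adj G x y → Anc F x y ⊎ Anc F y x

TreedepthLe : ∀ {n} → SimpleGraph n → ℕ → Set
TreedepthLe {n} G k = Σ (RootedForest n) λ F → Elimination G F × HeightLe F k

GraphClass : Set₁
GraphClass = ∀ {n} → SimpleGraph n → Set

UnboundedTreedepth : GraphClass → Set₁
UnboundedTreedepth 𝒞 =
  ∀ (k : ℕ) → Σ ℕ λ n → Σ (SimpleGraph n) λ G → 𝒞 G × ¬ TreedepthLe G k

DoubleCycleFreeDiam3 : ℕ → ℕ → GraphClass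
DoubleCycleFreeDiam3 a b G =
  SubgraphFree G (CV a b) × SubgraphFree G (CE a b) × DiamLe G 3

{-# OPTIONS --safe #-}
-- Let P be a path on N vertices coloured by c : ℕ → Bool, and join every vertex of P to one of
-- two new hubs according to its colour. If every vertex of P has a neighbour of the other colour
-- on P, every vertex is within distance 2 of both hubs, so the diameter is at most 3; and since
-- the graph contains P, a halving argument on an elimination forest gives treedepth > k once
-- N ≥ 2^k. A cycle that avoids one hub runs monotonically along P: all the way round if it also
-- avoids the other hub (impossible), and otherwise for m − 2 steps between two neighbours of the
-- other hub, which have the same colour. So if c (i + m − 2) ≠ c i for all i, every m-cycle
-- passes through both hubs. The two cycles of C^V_{a,b} share one vertex and those of C^E_{a,b}
-- one edge, so neither embeds when all a- and b-cycles pass through two distinct non-adjacent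
-- vertices. The colouring
-- c i = parity(i) + parity(⌊i/B⌋) with B even alternates inside blocks of length B and satisfies
-- c (i + qB) ≠ c i for odd q; B = 2 handles the lengths 4ℓ₁, 4ℓ₂ and B = 2ℓ − 2 the lengths 2ℓ.
module Submission where

open import Defs hiding (sym)
open import Data.Bool using (Bool; true; false; not; _xor_) renaming (_≟_ to _≟ᵇ_)
open import Data.Bool.Properties using (¬-not; not-¬; not-distribˡ-xor; xor-same)
open import Data.Empty using (⊥; ⊥-elim)
open import Data.Fin using (Fin; toℕ; fromℕ<; zero; suc)
open import Data.Fin.Properties using (toℕ-fromℕ<; toℕ-injective; toℕ<n)
open import Data.Nat using (ℕ; zero; suc; _+_; _*_; _∸_; _^_; _≤_; _<_; z≤n; s≤s; _≤?_; _<?_; NonZero; >-nonZero⁻¹)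
open import Data.Nat.Properties
open import Data.Nat.DivMod
  using (_%_; _/_; _mod_; m≡m%n+[m/n]*n; [m+kn]%n≡m%n; [m+n]%n≡m%n; m<n⇒m%n≡m; m*n%n≡0; m%n<n;
         m<n⇒m/n≡0; m*n/n≡m; +-distrib-/-∣ʳ)
open import Data.Nat.Divisibility using (n∣m*n)
open import Data.Product using (Σ; Σ-syntax; _×_; _,_; proj₁; proj₂)
open import Data.Sum using (_⊎_; inj₁; inj₂; swap; [_,_]′)
import Data.Sum as ⊎
open import Data.Sum.Properties using (inj₁-injective; inj₂-injective)
open import Data.Unit using (⊤; tt)
open import Function using (_∘_; case_of_)
open import Relation.Nullary using (¬_; yes; no; ¬¬-excluded-middle)
open import Relation.Binary.PropositionalEquality

-- Rooted forests and long paths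

module _ {n} (F : RootedForest n) where

  Anc-trans : ∀ {x y z} → Anc F x y → Anc F y z → Anc F x z
  Anc-trans p self     = p
  Anc-trans p (up e q) = up e (Anc-trans p q)

  Anc⇒depth≤ : ∀ {x y} → Anc F x y → depth F x ≤ depth F y
  Anc⇒depth≤ self = ≤-refl
  Anc⇒depth≤ {y = y} (up {p = p} e q) =
    ≤-trans (Anc⇒depth≤ q) (≤-trans (n≤1+n _) (≤-reflexive (sym (depth-child F y p e))))

  Anc⇒depth< : ∀ {x y} → Anc F x y → x ≢ y → depth F x < depth F y
  Anc⇒depth< self x≢x = ⊥-elim (x≢x refl)
  Anc⇒depth< {y = y} (up {p = p} e q) _ =
    ≤-trans (s≤s (Anc⇒depth≤ q)) (≤-reflexive (sym (depth-child F y p e)))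

  Anc-comparable : ∀ {x y z} → Anc F x z → Anc F y z → Anc F x y ⊎ Anc F y x
  Anc-comparable self     q         = inj₂ q
  Anc-comparable (up e p) self      = inj₁ (up e p)
  Anc-comparable (up e p) (up e′ q) with trans (sym e) e′
  ... | refl = Anc-comparable p q

module _ {n} (G : SimpleGraph n) {F : RootedForest n} (elim : Elimination G F) where

  Anc-adjacent : ∀ {r u w} → Anc F r u → Adj G u w → Anc F r w ⊎ Anc F w r
  Anc-adjacent r≤u u~w with elim _ _ u~w
  ... | inj₁ u≤w = inj₁ (Anc-trans F r≤u u≤w)
  ... | inj₂ w≤u = Anc-comparable F r≤u w≤u

record PathIn {n} (G : SimpleGraph n) (N : ℕ) : Set where
  field
    vertexAt  : ℕ → Fin n
    injective : ∀ {i j} → i < N → j < N → vertexAt i ≡ vertexAt j → i ≡ j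
    adjacent  : ∀ {i} → suc i < N → Adj G (vertexAt i) (vertexAt (suc i))

_∈[_,_⟩ : ℕ → ℕ → ℕ → Set
i ∈[ s , e ⟩ = s ≤ i × i < e

beside-root : ∀ j {s e m} → s + 2 ^ suc j ≤ e → m ∈[ s , e ⟩ →
              Σ ℕ λ s′ → Σ ℕ λ e′ → s′ + 2 ^ j ≤ e′ × e′ ≤ e × (∀ {i} → i ∈[ s′ , e′ ⟩ → i ∈[ s , e ⟩ × i ≢ m)
beside-root j {s} {e} {m} long (s≤m , m<e) with s + 2 ^ j ≤? m
... | yes left-long = s , m , left-long , <⇒≤ m<e , λ (s≤i , i<m) → (s≤i , <-trans i<m m<e) , <⇒≢ i<m
... | no left-short = suc m , e , right-long , ≤-refl , λ (m<i , i<e) → (≤-trans s≤m (<⇒≤ m<i) , i<e) , >⇒≢ m<i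
  where
  right-long : suc m + 2 ^ j ≤ e
  right-long = begin
    suc m + 2 ^ j       ≤⟨ +-monoˡ-≤ (2 ^ j) (≰⇒> left-short) ⟩
    s + 2 ^ j + 2 ^ j   ≡⟨ +-assoc s (2 ^ j) (2 ^ j) ⟩
    s + (2 ^ j + 2 ^ j) ≡⟨ cong (λ x → s + (2 ^ j + x)) (+-identityʳ (2 ^ j)) ⟨
    s + 2 ^ suc j       ≤⟨ long ⟩
    e                   ∎
    where open ≤-Reasoning

module _ {n} {G : SimpleGraph n} {N} (P : PathIn G N)
         {F : RootedForest n} (elim : Elimination G F) where
  open PathIn P

  Root : ℕ → ℕ → ℕ → Set
  Root s e m = m ∈[ s , e ⟩ × (∀ {i} → i ∈[ s , e ⟩ → Anc F (vertexAt m) (vertexAt i))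

  root-singleton : ∀ s → Root s (suc s) s
  root-singleton s = (≤-refl , ≤-refl) , λ (s≤i , i<1+s) →
    subst (λ i → Anc F (vertexAt s) (vertexAt i)) (≤-antisym s≤i (≤-pred i<1+s)) self

  ∈-split-last : ∀ {s e i} → i ∈[ s , suc e ⟩ → i ∈[ s , e ⟩ ⊎ i ≡ e
  ∈-split-last (s≤i , i<1+e) with m≤n⇒m<n∨m≡n (≤-pred i<1+e)
  ... | inj₁ i<e  = inj₁ (s≤i , i<e)
  ... | inj₂ refl = inj₂ refl

  root-extend : ∀ {s e m} → Root s (suc e) m → suc e < N → Σ ℕ (Root s (suc (suc e)))
  root-extend {s} {e} {m} ((s≤m , m<1+e) , m-root) 1+e<N
    with Anc-adjacent G elim (m-root {e} (≤-trans s≤m (≤-pred m<1+e) , ≤-refl)) (adjacent {e} 1+e<N)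
  ... | inj₁ m≤new = m , (s≤m , ≤-trans m<1+e (n≤1+n _)) , λ i∈ → case ∈-split-last i∈ of λ where
          (inj₁ i∈old) → m-root i∈old
          (inj₂ refl)  → m≤new
  ... | inj₂ new≤m = suc e , (≤-trans s≤m (<⇒≤ m<1+e) , ≤-refl) , λ i∈ → case ∈-split-last i∈ of λ where
          (inj₁ i∈old) → Anc-trans F new≤m (m-root i∈old)
          (inj₂ refl)  → self

  segment-root : ∀ {s} e → s < e → e ≤ N → Σ ℕ (Root s e)
  segment-root (suc e) (s≤s s≤e) e<N with m≤n⇒m<n∨m≡n s≤e
  ... | inj₂ refl = e , root-singleton e
  segment-root (suc zero)    _ _   | inj₁ ()
  segment-root (suc (suc e)) _ e<N | inj₁ s<1+e = root-extend (proj₂ (segment-root (suc e) s<1+e (<⇒≤ e<N))) e<N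

  below-root : ∀ {s e m d} → Root s e m → e ≤ N → (∀ {i} → i ∈[ s , e ⟩ → d ≤ depth F (vertexAt i)) →
               ∀ {i} → i ∈[ s , e ⟩ × i ≢ m → suc d ≤ depth F (vertexAt i)
  below-root (m∈@(_ , m<e) , m-root) e≤N d≤ (i∈@(_ , i<e) , i≢m) = ≤-trans (s≤s (d≤ m∈))
    (Anc⇒depth< F (m-root i∈) (λ eq → i≢m (sym (injective (<-≤-trans m<e e≤N) (<-≤-trans i<e e≤N) eq))))

  DeepIn : ℕ → ℕ → ℕ → Set
  DeepIn s e h = Σ ℕ λ i → i ∈[ s , e ⟩ × h ≤ depth F (vertexAt i)

  -- Every other vertex of [s, e) lies strictly below its root, and one side of the root still
  -- contains 2^j consecutive path vertices.
  deep-vertex : ∀ j {s e d} → s + 2 ^ j ≤ e → e ≤ N →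
                (∀ {i} → i ∈[ s , e ⟩ → d ≤ depth F (vertexAt i)) → DeepIn s e (j + d)
  deep-vertex zero {s} {e} s+1≤e _ d≤ = s , s∈ , d≤ s∈
    where
    s∈ : s ∈[ s , e ⟩
    s∈ = ≤-refl , subst (_≤ e) (+-comm s 1) s+1≤e
  deep-vertex (suc j) {s} {e} {d} long e≤N d≤ =
    let m , root = segment-root e (≤-trans (m<m+n s (m^n>0 2 (suc j))) long) e≤N
        s′ , e′ , long′ , e′≤e , beside = beside-root j long (proj₁ root)
        i , i∈ , deep = deep-vertex j long′ (≤-trans e′≤e e≤N) (below-root root e≤N d≤ ∘ beside)
    in i , proj₁ (beside i∈) , subst (_≤ depth F (vertexAt i)) (+-suc j d) deep

PathIn⇒¬TreedepthLe : ∀ {n} {G : SimpleGraph n} {N k} → PathIn G N → 2 ^ k ≤ N → ¬ TreedepthLe G k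
PathIn⇒¬TreedepthLe {k = k} P 2^k≤N (F , elim , height) =
  let i , _ , k+0≤depth = deep-vertex P elim k 2^k≤N ≤-refl (λ _ → z≤n)
  in <⇒≱ (height (PathIn.vertexAt P i)) (subst (_≤ depth F (PathIn.vertexAt P i)) (+-identityʳ k) k+0≤depth)

-- Cycles

suc-% : ∀ t m .{{_ : NonZero m}} →
        (suc (t % m) < m × suc t % m ≡ suc (t % m)) ⊎ (suc (t % m) ≡ m × suc t % m ≡ 0)
suc-% t m with suc (t % m) <? m
... | yes 1+r<m = inj₁ (1+r<m , (begin
  suc t % m                       ≡⟨ cong (λ x → suc x % m) (m≡m%n+[m/n]*n t m) ⟩
  (suc (t % m) + t / m * m) % m   ≡⟨ [m+kn]%n≡m%n (suc (t % m)) (t / m) m ⟩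
  suc (t % m) % m                 ≡⟨ m<n⇒m%n≡m 1+r<m ⟩
  suc (t % m)                     ∎))
  where open ≡-Reasoning
... | no 1+r≮m = inj₂ (1+r≡m , (begin
  suc t % m                       ≡⟨ cong (λ x → suc x % m) (m≡m%n+[m/n]*n t m) ⟩
  (suc (t % m) + t / m * m) % m   ≡⟨ cong (λ x → (x + t / m * m) % m) 1+r≡m ⟩
  suc (t / m) * m % m             ≡⟨ m*n%n≡0 (suc (t / m)) m ⟩
  0                               ∎))
  where
  open ≡-Reasoning
  1+r≡m : suc (t % m) ≡ m
  1+r≡m = ≤-antisym (m%n<n t m) (≮⇒≥ 1+r≮m)

toℕ-mod : ∀ {i} n .{{_ : NonZero n}} → i < n → toℕ (i mod n) ≡ i
toℕ-mod n i<n = trans (toℕ-fromℕ< _) (m<n⇒m%n≡m i<n)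

%-distinct : ∀ {s t} m .{{_ : NonZero m}} → s < t → t < s + m → s % m ≢ t % m
%-distinct {s} {t} m s<t t<s+m r≡ with t / m ≤? s / m
... | yes q≤ = <⇒≱ s<t (begin
  t                    ≡⟨ m≡m%n+[m/n]*n t m ⟩
  t % m + t / m * m    ≤⟨ +-mono-≤ (≤-reflexive (sym r≡)) (*-monoˡ-≤ m q≤) ⟩
  s % m + s / m * m    ≡⟨ m≡m%n+[m/n]*n s m ⟨
  s                    ∎)
  where open ≤-Reasoning
... | no q≰ = <⇒≱ t<s+m (begin
  s + m                    ≡⟨ cong (_+ m) (m≡m%n+[m/n]*n s m) ⟩
  s % m + s / m * m + m    ≡⟨ +-assoc (s % m) _ m ⟩
  s % m + (s / m * m + m)  ≡⟨ cong₂ _+_ r≡ (+-comm _ m) ⟩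
  t % m + suc (s / m) * m  ≤⟨ +-monoʳ-≤ (t % m) (*-monoˡ-≤ m (≰⇒> q≰)) ⟩
  t % m + t / m * m        ≡⟨ m≡m%n+[m/n]*n t m ⟨
  t                        ∎)
  where open ≤-Reasoning

record Cycle {V : Set} (E : V → V → Set) (m : ℕ) : Set where
  field
    vertex   : ℕ → V
    adjacent : ∀ t → E (vertex t) (vertex (suc t))
    periodic : ∀ t → vertex (t + m) ≡ vertex t
    distinct : ∀ {s t} → s < t → t < s + m → vertex s ≢ vertex t
open Cycle public

module _ {V : Set} {E : V → V → Set} {m : ℕ} where

  rotate : Cycle E m → ℕ → Cycle E m
  rotate C r = record
    { vertex   = λ t → vertex C (r + t)
    ; adjacent = λ t → subst (λ x → E (vertex C (r + t)) (vertex C x)) (sym (+-suc r t)) (adjacent C (r + t))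
    ; periodic = λ t → trans (cong (vertex C) (sym (+-assoc r t m))) (periodic C (r + t))
    ; distinct = λ {s} {t} s<t t<s+m → distinct C (+-monoʳ-< r s<t)
                   (subst (r + t <_) (sym (+-assoc r s m)) (+-monoʳ-< r t<s+m))
    }

  CycE-mod : ∀ t .{{_ : NonZero m}} → CycE m (t mod m) (suc t mod m)
  CycE-mod t with suc-% t m
  ... | inj₁ (_ , 1+t%m≡) = inj₁ (trans (toℕ-fromℕ< _) (trans 1+t%m≡ (cong suc (sym (toℕ-fromℕ< _)))))
  ... | inj₂ (1+r≡m , 1+t%m≡0) = inj₂ (trans (toℕ-fromℕ< _) (cong (_∸ 1) 1+r≡m) , trans (toℕ-fromℕ< _) 1+t%m≡0)

  cycleOf : .{{_ : NonZero m}} (g : Fin m → V) → (∀ {i j} → g i ≡ g j → i ≡ j) →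
            (∀ {i j} → CycE m i j → E (g i) (g j)) → Cycle E m
  cycleOf g g-injective g-edge = record
    { vertex   = λ t → g (t mod m)
    ; adjacent = λ t → g-edge (CycE-mod t)
    ; periodic = λ t → cong g (toℕ-injective (trans (toℕ-fromℕ< _) (trans ([m+n]%n≡m%n t m) (sym (toℕ-fromℕ< _)))))
    ; distinct = λ s<t t<s+m eq → %-distinct m s<t t<s+m
                   (trans (sym (toℕ-fromℕ< _)) (trans (cong toℕ (g-injective eq)) (toℕ-fromℕ< _)))
    }

  Avoids : Cycle E m → V → Set
  Avoids C v = ∀ t → vertex C t ≢ v

-- Stated as ¬ Avoids rather than as a visit, so that proofs may split on whether some other
-- vertex is visited (by ¬¬-excluded-middle, the goal being ⊥).
Unavoidable : ∀ {n} → SimpleGraph n → ℕ → Fin n → Set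
Unavoidable G m v = (C : Cycle (Adj G) m) → ¬ Avoids C v

-- Cycles through two fixed vertices exclude C^V and C^E

record PatternCycle (P : Pattern) (m : ℕ) : Set where
  field
    at        : Fin m → PV P
    injective : ∀ {i j} → at i ≡ at j → i ≡ j
    edge      : ∀ {i j} → CycE m i j → PE P (at i) (at j) ⊎ PE P (at j) (at i)
open PatternCycle

module _ {n} {G : SimpleGraph n} {P : Pattern} where

  embed : ∀ {m} .{{_ : NonZero m}} → Contains G P → PatternCycle P m → Cycle (Adj G) m
  embed (f , f-injective , f-edge) C = cycleOf (f ∘ at C) (injective C ∘ f-injective _ _)
    ([ f-edge _ _ , SimpleGraph.sym G ∘ f-edge _ _ ]′ ∘ edge C)

  shared-vertex : ∀ {a b v} .{{_ : NonZero a}} .{{_ : NonZero b}} (emb : Contains G P)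
                  (C₁ : PatternCycle P a) (C₂ : PatternCycle P b) →
                  Unavoidable G a v → Unavoidable G b v →
                  ¬ ¬ (Σ[ i ∈ Fin a ] Σ[ j ∈ Fin b ] at C₁ i ≡ at C₂ j × v ≡ proj₁ emb (at C₁ i))
  shared-vertex {a} {b} emb@(_ , f-injective , _) C₁ C₂ v∈C₁ v∈C₂ no-shared =
    v∈C₁ (embed emb C₁) λ t₁ on₁ → v∈C₂ (embed emb C₂) λ t₂ on₂ →
      no-shared (t₁ mod a , t₂ mod b , f-injective _ _ (trans on₁ (sym on₂)) , sym on₁)

module _ {a b : ℕ} where

  CV-cycle₁ : PatternCycle (CV a b) a
  CV-cycle₁ = record { at = inj₁ ; injective = inj₁-injective ; edge = inj₁ }

  CE-cycle₁ : PatternCycle (CE a b) a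
  CE-cycle₁ = record { at = inj₁ ; injective = inj₁-injective ; edge = inj₁ }

  CV-cycle₂ : PatternCycle (CV (suc a) (suc (suc b))) (suc (suc b))
  CV-cycle₂ = record { at = at₂ ; injective = injective₂ ; edge = edge₂ }
    where
    at₂ : Fin (suc (suc b)) → Fin (suc a) ⊎ Fin (suc b)
    at₂ zero    = inj₁ zero
    at₂ (suc j) = inj₂ j
    injective₂ : ∀ {i j} → at₂ i ≡ at₂ j → i ≡ j
    injective₂ {zero}  {zero}  _  = refl
    injective₂ {suc _} {suc _} eq = cong suc (inj₂-injective eq)
    E : Fin (suc a) ⊎ Fin (suc b) → Fin (suc a) ⊎ Fin (suc b) → Set
    E = CVE (suc a) (suc (suc b))
    edge₂ : ∀ {i j} → CycE (suc (suc b)) i j → E (at₂ i) (at₂ j) ⊎ E (at₂ j) (at₂ i)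
    edge₂ {zero}  {suc _} (inj₁ 1≡)         = inj₁ (refl , inj₁ (suc-injective 1≡))
    edge₂ {suc _} {suc _} (inj₁ j≡)         = inj₁ (suc-injective j≡)
    edge₂ {suc _} {zero}  (inj₂ (i≡ , _))   = inj₂ (refl , inj₂ (suc-injective i≡))
    edge₂ {zero}  {zero}  (inj₁ ())
    edge₂ {zero}  {zero}  (inj₂ (() , _))
    edge₂ {zero}  {suc _} (inj₂ (() , _))
    edge₂ {suc _} {zero}  (inj₁ ())
    edge₂ {suc _} {suc _} (inj₂ (_ , ()))

  CV-cycles-meet : ∀ {i j} → inj₁ i ≡ PatternCycle.at CV-cycle₂ j → i ≡ zero
  CV-cycles-meet {j = zero} refl = refl

  CE-cycle₂ : PatternCycle (CE (suc (suc a)) (suc (suc b))) (suc (suc b))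
  CE-cycle₂ = record { at = at₂ ; injective = injective₂ ; edge = edge₂ }
    where
    at₂ : Fin (suc (suc b)) → Fin (suc (suc a)) ⊎ Fin b
    at₂ zero          = inj₁ (suc zero)
    at₂ (suc zero)    = inj₁ zero
    at₂ (suc (suc j)) = inj₂ j
    injective₂ : ∀ {i j} → at₂ i ≡ at₂ j → i ≡ j
    injective₂ {zero}        {zero}        _  = refl
    injective₂ {suc zero}    {suc zero}    _  = refl
    injective₂ {suc (suc _)} {suc (suc _)} eq = cong (λ k → suc (suc k)) (inj₂-injective eq)
    injective₂ {zero}        {suc zero}    ()
    injective₂ {suc zero}    {zero}        ()
    E : Fin (suc (suc a)) ⊎ Fin b → Fin (suc (suc a)) ⊎ Fin b → Set
    E = CEE (suc (suc a)) (suc (suc b))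
    edge₂ : ∀ {i j} → CycE (suc (suc b)) i j → E (at₂ i) (at₂ j) ⊎ E (at₂ j) (at₂ i)
    edge₂ {zero}        {suc zero}    (inj₁ _)          = inj₂ (inj₁ refl)
    edge₂ {suc zero}    {suc (suc _)} (inj₁ 2≡)         = inj₁ (inj₁ (refl , suc-injective (suc-injective 2≡)))
    edge₂ {suc (suc _)} {suc (suc _)} (inj₁ j≡)         = inj₁ (suc-injective (suc-injective j≡))
    edge₂ {suc zero}    {zero}        (inj₂ _)          = inj₁ (inj₁ refl)
    edge₂ {suc (suc _)} {zero}        (inj₂ (i≡ , _))   = inj₂ (inj₂ (refl , cong (_∸ 1) (suc-injective i≡)))
    edge₂ {zero}        {zero}        (inj₁ ())
    edge₂ {zero}        {suc (suc _)} (inj₁ ())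
    edge₂ {suc zero}    {suc zero}    (inj₁ ())
    edge₂ {suc _}       {zero}        (inj₁ ())
    edge₂ {suc (suc _)} {suc zero}    (inj₁ ())
    edge₂ {zero}        {_}           (inj₂ (() , _))
    edge₂ {suc _}       {suc _}       (inj₂ (_ , ()))

  CE-cycles-meet : ∀ {i j} → inj₁ i ≡ PatternCycle.at CE-cycle₂ j → i ≡ zero ⊎ i ≡ suc zero
  CE-cycles-meet {j = zero}     refl = inj₂ refl
  CE-cycles-meet {j = suc zero} refl = inj₁ refl

module _ {n} {G : SimpleGraph n} {a b : ℕ} {x y : Fin n} (x≢y : x ≢ y) where

  CV-free : 3 ≤ a → 3 ≤ b →
            Unavoidable G a x × Unavoidable G b x → Unavoidable G a y × Unavoidable G b y →
            SubgraphFree G (CV a b)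
  CV-free (s≤s (s≤s (s≤s _))) (s≤s (s≤s (s≤s _))) x-unavoidable y-unavoidable emb@(f , _) =
    at-apex x-unavoidable λ x≡ → at-apex y-unavoidable λ y≡ → x≢y (trans x≡ (sym y≡))
    where
    at-apex : ∀ {v} → Unavoidable G a v × Unavoidable G b v → ¬ ¬ (v ≡ f (inj₁ zero))
    at-apex (ua , ub) v≢apex = shared-vertex {G = G} emb CV-cycle₁ CV-cycle₂ ua ub λ (_ , _ , eq , v≡) →
      v≢apex (trans v≡ (cong (f ∘ inj₁) (CV-cycles-meet eq)))

  CE-free : ¬ Adj G x y → 3 ≤ a → 3 ≤ b →
            Unavoidable G a x × Unavoidable G b x → Unavoidable G a y × Unavoidable G b y →
            SubgraphFree G (CE a b)
  CE-free x≁y (s≤s (s≤s (s≤s _))) (s≤s (s≤s (s≤s _))) x-unavoidable y-unavoidable emb@(f , _ , f-edge) =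
    on-shared-edge x-unavoidable λ x≡ → on-shared-edge y-unavoidable λ y≡ → distinct-ends x≡ y≡
    where
    on-shared-edge : ∀ {v} → Unavoidable G a v × Unavoidable G b v →
                     ¬ ¬ (v ≡ f (inj₁ zero) ⊎ v ≡ f (inj₁ (suc zero)))
    on-shared-edge (ua , ub) off = shared-vertex {G = G} emb CE-cycle₁ CE-cycle₂ ua ub λ (_ , _ , eq , v≡) →
      off (⊎.map (trans v≡ ∘ cong (f ∘ inj₁)) (trans v≡ ∘ cong (f ∘ inj₁)) (CE-cycles-meet eq))
    shared-edge : Adj G (f (inj₁ zero)) (f (inj₁ (suc zero)))
    shared-edge = f-edge (inj₁ zero) (inj₁ (suc zero)) (inj₁ refl)
    distinct-ends : x ≡ f (inj₁ zero) ⊎ x ≡ f (inj₁ (suc zero)) →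
                    y ≡ f (inj₁ zero) ⊎ y ≡ f (inj₁ (suc zero)) → ⊥
    distinct-ends (inj₁ refl) (inj₁ refl) = x≢y refl
    distinct-ends (inj₂ refl) (inj₂ refl) = x≢y refl
    distinct-ends (inj₁ refl) (inj₂ refl) = x≁y shared-edge
    distinct-ends (inj₂ refl) (inj₁ refl) = x≁y (SimpleGraph.sym G shared-edge)

-- Sequences moving by unit steps

Consecutive : ℕ → ℕ → Set
Consecutive m n = n ≡ suc m ⊎ m ≡ suc n

module _ (h : ℕ → ℕ) where

  StepsUp StepsDown : ℕ → Set
  StepsUp   len = ∀ {u} → u < len → h (suc u) ≡ suc (h u)
  StepsDown len = ∀ {u} → u < len → h u ≡ suc (h (suc u))

  private
    extend : ∀ {P : ℕ → Set} {len} → (∀ {u} → u < len → P u) → P len → ∀ {u} → u < suc len → P u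
    extend below at-len {u} u<1+len with m≤n⇒m<n∨m≡n (≤-pred u<1+len)
    ... | inj₁ u<len = below u<len
    ... | inj₂ refl  = at-len

  steps-monotone : ∀ len → (∀ {u} → u < len → Consecutive (h u) (h (suc u))) →
                   (∀ {u} → suc (suc u) ≤ len → h u ≢ h (suc (suc u))) →
                   StepsUp len ⊎ StepsDown len
  steps-monotone zero _ _ = inj₁ λ ()
  steps-monotone (suc len) consecutive no-backtrack
    with steps-monotone len (consecutive ∘ m<n⇒m<1+n) (no-backtrack ∘ m≤n⇒m≤1+n) | consecutive (n<1+n len)
  ... | inj₁ ups   | inj₁ last-up   = inj₁ (extend ups last-up)
  ... | inj₂ downs | inj₂ last-down = inj₂ (extend downs last-down)
  steps-monotone (suc zero) _ _ | inj₁ _ | inj₂ last-down = inj₂ λ { (s≤s z≤n) → last-down }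
  steps-monotone (suc zero) _ _ | inj₂ _ | inj₁ last-up = inj₁ λ { (s≤s z≤n) → last-up }
  steps-monotone (suc (suc len)) _ no-backtrack | inj₁ ups | inj₂ last-down =
    ⊥-elim (no-backtrack ≤-refl (suc-injective (trans (sym (ups (n<1+n len))) last-down)))
  steps-monotone (suc (suc len)) _ no-backtrack | inj₂ downs | inj₁ last-up =
    ⊥-elim (no-backtrack ≤-refl (trans (downs (n<1+n len)) (sym last-up)))

  StepsUp⇒ : ∀ {len} → StepsUp len → h len ≡ h 0 + len
  StepsUp⇒ {zero}    _   = sym (+-identityʳ (h 0))
  StepsUp⇒ {suc len} ups = begin
    h (suc len)       ≡⟨ ups (n<1+n len) ⟩
    suc (h len)       ≡⟨ cong suc (StepsUp⇒ (ups ∘ m<n⇒m<1+n)) ⟩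
    suc (h 0 + len)   ≡⟨ +-suc (h 0) len ⟨
    h 0 + suc len     ∎
    where open ≡-Reasoning

  StepsDown⇒ : ∀ {len} → StepsDown len → h 0 ≡ h len + len
  StepsDown⇒ {zero}    _     = sym (+-identityʳ (h 0))
  StepsDown⇒ {suc len} downs = begin
    h 0                   ≡⟨ StepsDown⇒ (downs ∘ m<n⇒m<1+n) ⟩
    h len + len           ≡⟨ cong (_+ len) (downs (n<1+n len)) ⟩
    suc (h (suc len)) + len ≡⟨ +-suc (h (suc len)) len ⟨
    h (suc len) + suc len ∎
    where open ≡-Reasoning

  monotone-ends : ∀ {len} → StepsUp len ⊎ StepsDown len → h len ≡ h 0 + len ⊎ h 0 ≡ h len + len
  monotone-ends = ⊎.map StepsUp⇒ StepsDown⇒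

-- The two-hub path

module _ {n} (G : SimpleGraph n) where

  DistLe-snoc : ∀ {m x y z} → DistLe G m x y → Adj G y z → DistLe G (suc m) x z
  DistLe-snoc here       e = step e here
  DistLe-snoc (step d p) e = step d (DistLe-snoc p e)

  DistLe-sym : ∀ {m x y} → DistLe G m x y → DistLe G m y x
  DistLe-sym here       = here
  DistLe-sym (step e p) = DistLe-snoc (DistLe-sym p) (SimpleGraph.sym G e)

≡not⇒≢ : ∀ {x y : Bool} → x ≡ not y → x ≢ y
≡not⇒≢ x≡¬y x≡y = not-¬ refl (trans (sym x≡y) x≡¬y)

≢∧≢⇒≡ : ∀ {x y z : Bool} → x ≢ y → y ≢ z → x ≡ z
≢∧≢⇒≡ x≢y y≢z = trans (¬-not x≢y) (sym (¬-not (y≢z ∘ sym)))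

Antiperiodic : (ℕ → Bool) → ℕ → Set
Antiperiodic c d = ∀ i → c (i + d) ≢ c i

module TwoHubPath (N : ℕ) (c : ℕ → Bool) where

  Vertex : Set
  Vertex = Fin (2 + N)

  hub : Bool → Vertex
  hub true  = zero
  hub false = suc zero

  pattern path i = suc (suc i)

  Adjacent : Vertex → Vertex → Set
  Adjacent (path i)   (path j)   = Consecutive (toℕ i) (toℕ j)
  Adjacent zero       (path j)   = c (toℕ j) ≡ true
  Adjacent (suc zero) (path j)   = c (toℕ j) ≡ false
  Adjacent (path i)   zero       = c (toℕ i) ≡ true
  Adjacent (path i)   (suc zero) = c (toℕ i) ≡ false
  Adjacent _          _          = ⊥

  Adjacent-sym : ∀ {u v} → Adjacent u v → Adjacent v u
  Adjacent-sym {path _}   {path _}   = swap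
  Adjacent-sym {zero}     {path _}   e = e
  Adjacent-sym {suc zero} {path _}   e = e
  Adjacent-sym {path _}   {zero}     e = e
  Adjacent-sym {path _}   {suc zero} e = e
  Adjacent-sym {zero}     {zero}     ()
  Adjacent-sym {zero}     {suc zero} ()
  Adjacent-sym {suc zero} {zero}     ()
  Adjacent-sym {suc zero} {suc zero} ()

  Adjacent-irrefl : ∀ {v} → ¬ Adjacent v v
  Adjacent-irrefl {path i} (inj₁ i≡1+i) = 1+n≢n (sym i≡1+i)
  Adjacent-irrefl {path i} (inj₂ i≡1+i) = 1+n≢n (sym i≡1+i)

  graph : SimpleGraph (2 + N)
  graph = record { Adj = Adjacent ; sym = Adjacent-sym ; irrefl = Adjacent-irrefl }

  spoke : ∀ {b i} → c (toℕ i) ≡ b → Adjacent (hub b) (path i)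
  spoke {true}  i∈b = i∈b
  spoke {false} i∈b = i∈b

  data Site : Vertex → Set where
    hub-site  : ∀ b → Site (hub b)
    path-site : ∀ i → Site (path i)

  site : ∀ v → Site v
  site zero       = hub-site true
  site (suc zero) = hub-site false
  site (path i)   = path-site i

  OnPath : Vertex → Set
  OnPath (path _) = ⊤
  OnPath _        = ⊥

  -- Junk value 0 at the hubs; it is only used at OnPath vertices.
  position : Vertex → ℕ
  position (path i) = toℕ i
  position _        = 0

  off-hubs⇒OnPath : ∀ {v} b → v ≢ hub b → v ≢ hub (not b) → OnPath v
  off-hubs⇒OnPath {zero}     true  ≢t _  = ≢t refl
  off-hubs⇒OnPath {zero}     false _  ≢t = ≢t refl
  off-hubs⇒OnPath {suc zero} true  _  ≢f = ≢f refl
  off-hubs⇒OnPath {suc zero} false ≢f _  = ≢f refl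
  off-hubs⇒OnPath {path _}   _     _  _  = tt

  path-consecutive : ∀ {u v} → OnPath u → OnPath v → Adjacent u v → Consecutive (position u) (position v)
  path-consecutive {path _} {path _} _ _ u~v = u~v

  position-injective : ∀ {u v} → OnPath u → OnPath v → position u ≡ position v → u ≡ v
  position-injective {path _} {path _} _ _ eq = cong path (toℕ-injective eq)

  hub-colour : ∀ {b v} → OnPath v → Adjacent (hub b) v → c (position v) ≡ b
  hub-colour {true}  {path _} _ v∈b = v∈b
  hub-colour {false} {path _} _ v∈b = v∈b

  module _ {d} (1≤d : 1 ≤ d) (C : Cycle Adjacent (2 + d)) where

    run : ℕ → ℕ → ℕ
    run s u = position (vertex C (s + u))

    monotone-run : ∀ s len → (∀ {u} → u ≤ len → OnPath (vertex C (s + u))) →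
                   run s len ≡ run s 0 + len ⊎ run s 0 ≡ run s len + len
    monotone-run s len on-path = monotone-ends (run s) (steps-monotone (run s) len consecutive no-backtrack)
      where
      consecutive : ∀ {u} → u < len → Consecutive (run s u) (run s (suc u))
      consecutive {u} u<len = path-consecutive (on-path (<⇒≤ u<len)) (on-path u<len)
        (subst (Adjacent (vertex C (s + u)) ∘ vertex C) (sym (+-suc s u)) (adjacent C (s + u)))
      no-backtrack : ∀ {u} → suc (suc u) ≤ len → run s u ≢ run s (suc (suc u))
      no-backtrack {u} 2+u≤len eq = distinct C (+-monoʳ-< s (m<n⇒m<1+n (n<1+n u)))
        (subst (_< s + u + (2 + d)) (trans (+-assoc s u 2) (cong (s +_) (+-comm u 2)))
               (+-monoʳ-< (s + u) (s≤s (s≤s 1≤d))))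
        (position-injective (on-path (≤-trans (n≤1+n _) (<⇒≤ 2+u≤len))) (on-path 2+u≤len) eq)

    cycle-leaves-path : (∀ t → OnPath (vertex C t)) → ⊥
    cycle-leaves-path on-path with monotone-run 0 (2 + d) (λ {u} _ → on-path u)
    ... | inj₁ ascending  = m+1+n≢m (run 0 0) (trans (sym ascending) (cong position (periodic C 0)))
    ... | inj₂ descending =
      m+1+n≢m (run 0 0) (sym (trans descending (cong (λ v → position v + (2 + d)) (periodic C 0))))

    -- The d + 1 vertices after the hub run monotonically along the path; the first and the last
    -- are both joined to the hub, so they share its colour although they are d apart.
    single-hub-impossible : ∀ {b} → Antiperiodic c d → vertex C 0 ≡ hub (not b) → Avoids C (hub b) → ⊥
    single-hub-impossible {b} anti starts-at-hub avoids = [ rising , falling ]′ (monotone-run 1 d on-path)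
      where
      on-path : ∀ {u} → u ≤ d → OnPath (vertex C (1 + u))
      on-path {u} u≤d = off-hubs⇒OnPath b (avoids (1 + u))
        λ eq → distinct C {0} (s≤s z≤n) (s≤s (s≤s u≤d)) (trans starts-at-hub (sym eq))
      first-colour : c (run 1 0) ≡ not b
      first-colour = hub-colour (on-path z≤n)
        (subst (λ v → Adjacent v (vertex C 1)) starts-at-hub (adjacent C 0))
      last-colour : c (run 1 d) ≡ not b
      last-colour = hub-colour (on-path ≤-refl) (Adjacent-sym
        (subst (Adjacent (vertex C (1 + d))) (trans (periodic C 0) starts-at-hub) (adjacent C (1 + d))))
      rising : run 1 d ≡ run 1 0 + d → ⊥
      rising ascending = anti (run 1 0) (trans (cong c (sym ascending)) (trans last-colour (sym first-colour)))
      falling : run 1 0 ≡ run 1 d + d → ⊥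
      falling descending = anti (run 1 d) (trans (cong c (sym descending)) (trans first-colour (sym last-colour)))

  hubs-unavoidable : ∀ {d} → 1 ≤ d → Antiperiodic c d → ∀ b → Unavoidable graph (2 + d) (hub b)
  hubs-unavoidable 1≤d anti b C avoids =
    ¬¬-excluded-middle {A = Σ ℕ λ t → vertex C t ≡ hub (not b)} λ where
      (yes (t , at-other-hub)) → single-hub-impossible 1≤d (rotate C t) anti
                                   (trans (cong (vertex C) (+-identityʳ t)) at-other-hub) (avoids ∘ (t +_))
      (no never-other-hub)     → cycle-leaves-path 1≤d C λ t →
                                   off-hubs⇒OnPath b (avoids t) (never-other-hub ∘ (t ,_))

  OppositeNeighbours : Set
  OppositeNeighbours = ∀ (i : Fin N) → Σ[ j ∈ Fin N ] Consecutive (toℕ i) (toℕ j) × c (toℕ j) ≢ c (toℕ i)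

  module _ (opposite : OppositeNeighbours) where

    coloured-near : ∀ i b → Σ[ j ∈ Fin N ] (j ≡ i ⊎ Consecutive (toℕ i) (toℕ j)) × c (toℕ j) ≡ b
    coloured-near i b with c (toℕ i) ≟ᵇ b
    ... | yes i∈b = i , inj₁ refl , i∈b
    ... | no  i∉b with opposite i
    ...   | j , i~j , j≢i = j , inj₂ i~j , ≢∧≢⇒≡ j≢i i∉b

    path-to-hub : ∀ {m} i b → DistLe graph (2 + m) (path i) (hub b)
    path-to-hub i b with coloured-near i b
    ... | j , inj₁ refl , j∈b = step (Adjacent-sym (spoke j∈b)) here
    ... | j , inj₂ i~j  , j∈b = step i~j (step (Adjacent-sym (spoke j∈b)) here)

    diameter≤3 : Fin N → DiamLe graph 3
    diameter≤3 i₀ u v with site u | site v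
    ... | hub-site b  | hub-site b′ =
      let i , _ , i∈b = coloured-near i₀ b in step (spoke i∈b) (path-to-hub i b′)
    ... | hub-site b  | path-site j = DistLe-sym graph (path-to-hub j b)
    ... | path-site i | hub-site b  = path-to-hub i b
    ... | path-site i | path-site j =
      step (Adjacent-sym (spoke refl)) (DistLe-sym graph (path-to-hub j (c (toℕ i))))

  path-subgraph : .{{_ : NonZero N}} → PathIn graph N
  path-subgraph = record
    { vertexAt  = λ i → path (i mod N)
    ; injective = λ i<N j<N eq → trans (sym (toℕ-mod N i<N)) (trans (cong position eq) (toℕ-mod N j<N))
    ; adjacent  = λ {i} 1+i<N →
        inj₁ (trans (toℕ-mod N 1+i<N) (cong suc (sym (toℕ-mod N (<-trans (n<1+n i) 1+i<N)))))
    }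

  graph-in-class : ∀ {a b} → 3 ≤ a → 3 ≤ b → Antiperiodic c (a ∸ 2) → Antiperiodic c (b ∸ 2) →
                   Fin N → OppositeNeighbours → DoubleCycleFreeDiam3 a b graph
  graph-in-class {a} {b} 3≤a@(s≤s (s≤s 1≤a∸2)) 3≤b@(s≤s (s≤s 1≤b∸2)) anti-a anti-b i₀ opposite =
      CV-free {G = graph} hubs-distinct 3≤a 3≤b (on-all-cycles true) (on-all-cycles false)
    , CE-free {G = graph} hubs-distinct (λ ()) 3≤a 3≤b (on-all-cycles true) (on-all-cycles false)
    , diameter≤3 opposite i₀
    where
    hubs-distinct : hub true ≢ hub false
    hubs-distinct ()
    on-all-cycles : ∀ h → Unavoidable graph a (hub h) × Unavoidable graph b (hub h)
    on-all-cycles h = hubs-unavoidable 1≤a∸2 anti-a h , hubs-unavoidable 1≤b∸2 anti-b h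

-- Block colourings

odd : ℕ → Bool
odd zero    = false
odd (suc n) = not (odd n)

odd-+ : ∀ m n → odd (m + n) ≡ odd m xor odd n
odd-+ zero    n = refl
odd-+ (suc m) n = trans (cong not (odd-+ m n)) (not-distribˡ-xor (odd m) (odd n))

odd-*-even : ∀ q {B} → odd B ≡ false → odd (q * B) ≡ false
odd-*-even zero    _    = refl
odd-*-even (suc q) {B} even = trans (odd-+ B (q * B)) (cong₂ _xor_ even (odd-*-even q even))

odd-double : ∀ m → odd (2 * m) ≡ false
odd-double m = trans (odd-+ m (m + 0)) (trans (cong (λ k → odd m xor odd k) (+-identityʳ m)) (xor-same (odd m)))

module _ (B : ℕ) .{{_ : NonZero B}} where

  blockColour : ℕ → Bool
  blockColour i = odd i xor odd (i / B)

  suc-/ : ∀ {t} → suc (t % B) < B → suc t / B ≡ t / B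
  suc-/ {t} 1+r<B = begin
    suc t / B                           ≡⟨ cong (λ x → suc x / B) (m≡m%n+[m/n]*n t B) ⟩
    (suc (t % B) + t / B * B) / B       ≡⟨ +-distrib-/-∣ʳ (suc (t % B)) (n∣m*n (t / B)) ⟩
    suc (t % B) / B + t / B * B / B     ≡⟨ cong₂ _+_ (m<n⇒m/n≡0 1+r<B) (m*n/n≡m (t / B) B) ⟩
    t / B                               ∎
    where open ≡-Reasoning

  blockColour-suc : ∀ {t} → suc (t % B) < B → blockColour (suc t) ≡ not (blockColour t)
  blockColour-suc {t} 1+r<B = trans (cong (λ q → not (odd t) xor odd q) (suc-/ 1+r<B))
                                    (sym (not-distribˡ-xor (odd t) (odd (t / B))))

  blockColour-antiperiodic : ∀ q → odd B ≡ false → odd q ≡ true → Antiperiodic blockColour (q * B)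
  blockColour-antiperiodic q even odd-q i = ≡not⇒≢ (begin
    blockColour (i + q * B)                        ≡⟨⟩
    odd (i + q * B) xor odd ((i + q * B) / B)
      ≡⟨ cong₂ _xor_ (odd-+ i (q * B)) (cong odd quotient) ⟩
    (odd i xor odd (q * B)) xor odd (i / B + q)
      ≡⟨ cong₂ (λ x y → (odd i xor x) xor y) (odd-*-even q even) (odd-+ (i / B) q) ⟩
    (odd i xor false) xor (odd (i / B) xor odd q)
      ≡⟨ cong (λ x → (odd i xor false) xor (odd (i / B) xor x)) odd-q ⟩
    (odd i xor false) xor (odd (i / B) xor true)   ≡⟨ flip (odd i) (odd (i / B)) ⟩
    not (blockColour i)                            ∎)
    where
    open ≡-Reasoning
    quotient : (i + q * B) / B ≡ i / B + q
    quotient = trans (+-distrib-/-∣ʳ i (n∣m*n q)) (cong (i / B +_) (m*n/n≡m q B))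
    flip : ∀ x y → (x xor false) xor (y xor true) ≡ not (x xor y)
    flip false false = refl
    flip false true  = refl
    flip true  false = refl
    flip true  true  = refl

  module _ (2≤B : 2 ≤ B) (M : ℕ) where

    private
      not-first-and-last : ∀ {t} → t % B ≡ 0 → suc (t % B) ≢ B
      not-first-and-last r≡0 1+r≡B = <⇒≢ 2≤B (trans (sym (cong suc r≡0)) 1+r≡B)

    opposite-neighbour : ∀ t → t < M * B →
                         Σ ℕ λ u → u < M * B × Consecutive t u × blockColour u ≢ blockColour t
    opposite-neighbour t t<MB with suc-% t B
    ... | inj₁ (1+r<B , 1+t%B≡) = suc t , 1+t<MB , inj₁ refl , ≡not⇒≢ (blockColour-suc 1+r<B)
      where
      1+t<MB : suc t < M * B
      1+t<MB = ≤∧≢⇒< t<MB λ 1+t≡MB → 0≢1+n (trans (sym (trans (cong (_% B) 1+t≡MB) (m*n%n≡0 M B))) 1+t%B≡)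
    ... | inj₂ (1+r≡B , _) with t
    ...   | zero = ⊥-elim (not-first-and-last (m<n⇒m%n≡m (≤-trans (s≤s z≤n) 2≤B)) 1+r≡B)
    ...   | suc t′ with suc-% t′ B
    ...     | inj₁ (1+r′<B , _) = t′ , <-trans (n<1+n t′) t<MB , inj₂ refl ,
                                  ≢-sym (≡not⇒≢ (blockColour-suc 1+r′<B))
    ...     | inj₂ (_ , t%B≡0)  = ⊥-elim (not-first-and-last t%B≡0 1+r≡B)

    blockColour-opposite : TwoHubPath.OppositeNeighbours (M * B) blockColour
    blockColour-opposite i with opposite-neighbour (toℕ i) (toℕ<n i)
    ... | u , u<MB , consecutive , differs =
      fromℕ< u<MB , subst (Consecutive (toℕ i)) (sym (toℕ-fromℕ< u<MB)) consecutive ,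
                    subst (λ x → blockColour x ≢ _) (sym (toℕ-fromℕ< u<MB)) differs

  unbounded-treedepth : 2 ≤ B → ∀ {a b} → 3 ≤ a → 3 ≤ b →
                        Antiperiodic blockColour (a ∸ 2) → Antiperiodic blockColour (b ∸ 2) →
                        UnboundedTreedepth (DoubleCycleFreeDiam3 a b)
  unbounded-treedepth 2≤B 3≤a 3≤b anti-a anti-b k =
      2 + N , graph
    , graph-in-class 3≤a 3≤b anti-a anti-b (fromℕ< (>-nonZero⁻¹ N)) (blockColour-opposite 2≤B (2 ^ k))
    , PathIn⇒¬TreedepthLe path-subgraph (m≤m*n (2 ^ k) B)
    where
    instance
      2^k≢0 : NonZero (2 ^ k)
      2^k≢0 = m^n≢0 2 k
      N≢0 : NonZero (2 ^ k * B)
      N≢0 = m*n≢0 (2 ^ k) B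
    N : ℕ
    N = 2 ^ k * B
    open TwoHubPath N blockColour

3≤4*ℓ : ∀ {ℓ} → 1 ≤ ℓ → 3 ≤ 4 * ℓ
3≤4*ℓ 1≤ℓ = ≤-trans (s≤s (s≤s (s≤s z≤n))) (*-monoʳ-≤ 4 1≤ℓ)

antiperiodic-4ℓ∸2 : ∀ ℓ → 1 ≤ ℓ → Antiperiodic (blockColour 2) (4 * ℓ ∸ 2)
antiperiodic-4ℓ∸2 (suc m) _ = subst (Antiperiodic (blockColour 2)) (sym 4ℓ∸2≡)
  (blockColour-antiperiodic 2 (suc (2 * m)) refl (cong not (odd-double m)))
  where
  4ℓ∸2≡ : 4 * suc m ∸ 2 ≡ suc (2 * m) * 2
  4ℓ∸2≡ = trans (cong (_∸ 2) (*-suc 4 m)) (cong (2 +_) (trans (*-assoc 2 2 m) (*-comm 2 (2 * m))))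

3≤2*ℓ : ∀ {ℓ} → 2 ≤ ℓ → 3 ≤ 2 * ℓ
3≤2*ℓ 2≤ℓ = ≤-trans (s≤s (s≤s (s≤s z≤n))) (*-monoʳ-≤ 2 2≤ℓ)

antiperiodic-2ℓ∸2 : ∀ h → Antiperiodic (blockColour (2 * suc h)) (2 * suc (suc h) ∸ 2)
antiperiodic-2ℓ∸2 h = subst (Antiperiodic (blockColour (2 * suc h))) 2ℓ∸2≡
  (blockColour-antiperiodic (2 * suc h) 1 (odd-double (suc h)) refl)
  where
  2ℓ∸2≡ : 1 * (2 * suc h) ≡ 2 * suc (suc h) ∸ 2
  2ℓ∸2≡ = trans (*-identityˡ _) (sym (cong (_∸ 2) (*-suc 2 (suc h))))

-- The construction only needs ℓ₁, ℓ₂ ≥ 1 and ℓ ≥ 2.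
theorem22 : ((ℓ₁ ℓ₂ : ℕ) → 2 ≤ ℓ₁ → 2 ≤ ℓ₂ →
               UnboundedTreedepth (DoubleCycleFreeDiam3 (4 * ℓ₁) (4 * ℓ₂)))
            × ((ℓ : ℕ) → 4 ≤ ℓ →
               UnboundedTreedepth (DoubleCycleFreeDiam3 (2 * ℓ) (2 * ℓ)))
theorem22 = lengths-4ℓ , lengths-2ℓ
  where
  lengths-4ℓ : (ℓ₁ ℓ₂ : ℕ) → 2 ≤ ℓ₁ → 2 ≤ ℓ₂ → UnboundedTreedepth (DoubleCycleFreeDiam3 (4 * ℓ₁) (4 * ℓ₂))
  lengths-4ℓ ℓ₁ ℓ₂ (s≤s _) (s≤s _) = unbounded-treedepth 2 ≤-refl (3≤4*ℓ (s≤s z≤n)) (3≤4*ℓ (s≤s z≤n))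
    (antiperiodic-4ℓ∸2 ℓ₁ (s≤s z≤n)) (antiperiodic-4ℓ∸2 ℓ₂ (s≤s z≤n))
  lengths-2ℓ : (ℓ : ℕ) → 4 ≤ ℓ → UnboundedTreedepth (DoubleCycleFreeDiam3 (2 * ℓ) (2 * ℓ))
  lengths-2ℓ (suc (suc h)) (s≤s (s≤s _)) = unbounded-treedepth (2 * suc h) (*-monoʳ-≤ 2 (s≤s z≤n))
    (3≤2*ℓ (s≤s (s≤s z≤n))) (3≤2*ℓ (s≤s (s≤s z≤n))) (antiperiodic-2ℓ∸2 h) (antiperiodic-2ℓ∸2 h)
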